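{- For integers $d\ge 0$ and $n\ge 1$ let $\sigma_d(n)=\sum_{\ell\mid n}\ell^d$ (sum over positive divisors), and define $q^{\sigma_d}(n)$, $n\ge 0$, by \[ \sum_{n=0}^{\infty} q^{\sigma_d}(n)\, t^n = \frac{1}{1-\sum_{n=1}^{\infty} \sigma_d(n)\, t^n}. \] For $n\ge 3$ let \[ D^{\sigma}(n) = \begin{cases} 2n\log_{9/8}(3), & n\equiv 0\pmod 3,\\ (2n+1)\log_{9/8}(3) - \log_{9/8}(n+2), & n\equiv 1 \pmod 3,\\ \log_{9/8}(2) + (n+1)\log_{9/8}(3), & n\equiv 2\pmod 3,\ n\neq 5,\\ \log_{9/8}(3888), & n=5. \end{cases} \] Let $n\geq 3$ and let $d > D^{\sigma}(n)$. Then \[ \frac{\left(q^{\sigma_d}(n)\right)^2}{q^{\sigma_d}(n-1)\, q^{\sigma_d}(n+1)} < 1 \quad\text{if and only if}\quad n\equiv 1\pmod 3. \]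
   Context: $\log_{9/8}$ denotes the logarithm to base $9/8$. -}

module Defs where

open import Data.Nat using (ℕ; zero; suc; _+_; _*_; _^_; _<_; _%_)
open import Data.Nat.Divisibility using (_∣?_)
open import Data.List using (List; []; _∷_; map; filter; upTo; zipWith)
open import Data.Nat.ListAction using (sum)
open import Data.Product using (_×_)
open import Relation.Binary.PropositionalEquality using (_≡_; _≢_)

oneTo : ℕ → List ℕ
oneTo n = map suc (upTo n)

σ : ℕ → ℕ → ℕ
σ d n = sum (map (λ ℓ → ℓ ^ d) (filter (λ ℓ → ℓ ∣? n) (oneTo n)))

-- qList d n = [q(n), q(n-1), ..., q(0)], where
--   q(0) = 1,  q(m) = Σ_{k=1}^{m} σ_d(k) q(m-k)   (m ≥ 1),
-- which is exactly the coefficient recursion of 1 / (1 - Σ_{m≥1} σ_d(m) t^m).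
qList : ℕ → ℕ → List ℕ
qList d zero = 1 ∷ []
qList d (suc n) = sum (zipWith _*_ (map (σ d) (oneTo (suc n))) prev) ∷ prev
  where prev = qList d n

q : ℕ → ℕ → ℕ
q d n with qList d n
... | x ∷ _ = x
... | [] = 0

-- d > D^σ(n), with d > log_{9/8}(X) rewritten as (9/8)^d > X,
-- i.e. 9^d > X · 8^d (cleared of denominators).
DBound : ℕ → ℕ → Set
DBound n d =
  (n % 3 ≡ 0 → 3 ^ (2 * n) * 8 ^ d < 9 ^ d) ×
  (n % 3 ≡ 1 → 3 ^ (2 * n + 1) * 8 ^ d < (n + 2) * 9 ^ d) ×
  (n % 3 ≡ 2 → n ≢ 5 → 2 * 3 ^ (n + 1) * 8 ^ d < 9 ^ d) ×
  (n ≡ 5 → 3888 * 8 ^ d < 9 ^ d)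

module Submission where

-- q d n is the sum, over the compositions of n, of the products of σ d over the parts, and
-- ℓ^d ≤ σ d ℓ ≤ (1 + (ℓ - 1) / 2^d) ℓ^d. A composition of n whose product of parts is not the maximum
-- maxProd n (3^k, 2·3^k or 4·3^k) falls short of it by a factor of at least 9/8, so for large d
--   maxCount n · maxProd n ^ d ≤ q d n ≤ (maxCount n + (8/9)^d 3^n) · maxProd n ^ d,
-- with maxCount n the number of maximal compositions. The ratio maxProd n ² / (maxProd (n-1) maxProd (n+1))
-- is 9/8, 8/9 or 1 for n ≡ 0, 1, 2 (mod 3); in the last case the counts k + 2 against (k+1)(k+4)/2
-- and 1 still favour q d n ².

open import Data.Bool using (Bool; true; false; if_then_else_)
open import Data.Empty using (⊥-elim)
open import Data.Fin using (zero; suc)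
open import Data.List using (_∷_; map; filter; zipWith; upTo; applyUpTo; _++_; [_])
open import Data.List.Properties using (map-upTo; upTo-∷ʳ; map-++; filter-++; filter-accept; filter-reject)
open import Data.Nat
open import Data.Nat.Divisibility using (_∣_; _∣?_; divides; ∣-refl)
open import Data.Nat.ListAction using (sum)
open import Data.Nat.ListAction.Properties using (sum-++)
open import Data.Nat.DivMod using (_divMod_; result; [m+kn]%n≡m%n)
open import Data.Nat.Induction using (<-rec)
open import Data.Nat.Properties
open import Algebra.Properties.CommutativeSemigroup +-commutativeSemigroup
  using (interchange) renaming (x∙yz≈y∙xz to x+[y+z]≡y+[x+z])
open import Algebra.Properties.CommutativeSemigroup *-commutativeSemigroup
  using () renaming (x∙yz≈y∙xz to x*[y*z]≡y*[x*z])
open import Data.Nat.Tactic.RingSolver using (solve-∀)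
open import Data.Product using (_,_)
open import Data.Sum using (_⊎_; inj₁; inj₂)
import Data.Sum as Sum
open import Function using (_∘_)
open import Function.Bundles using (_⇔_; mk⇔; module Equivalence)
open import Relation.Binary.PropositionalEquality hiding ([_])
open import Relation.Nullary using (¬_; Dec; does; yes; no)
open import Relation.Nullary.Decidable using (does-⇔; dec-true; dec-false; toWitness; _⊎-dec_; _→-dec_)

open import Defs

-- Finite sums

∑< : ℕ → (ℕ → ℕ) → ℕ
∑< zero    F = 0
∑< (suc k) F = F 0 + ∑< k (F ∘ suc)

syntax ∑< k (λ i → e) = ∑[ i < k ] e

∑<-mono-≤ : ∀ k {F G : ℕ → ℕ} → (∀ i → i < k → F i ≤ G i) → ∑< k F ≤ ∑< k G
∑<-mono-≤ zero    F≤G = z≤n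
∑<-mono-≤ (suc k) F≤G = +-mono-≤ (F≤G 0 z<s) (∑<-mono-≤ k (λ i i<k → F≤G (suc i) (s<s i<k)))

∑<-cong : ∀ k {F G : ℕ → ℕ} → (∀ i → i < k → F i ≡ G i) → ∑< k F ≡ ∑< k G
∑<-cong zero    F≡G = refl
∑<-cong (suc k) F≡G = cong₂ _+_ (F≡G 0 z<s) (∑<-cong k (λ i i<k → F≡G (suc i) (s<s i<k)))

∑<-distrib-+ : ∀ k (F G : ℕ → ℕ) → ∑[ i < k ] (F i + G i) ≡ ∑< k F + ∑< k G
∑<-distrib-+ zero    F G = refl
∑<-distrib-+ (suc k) F G = begin
  F 0 + G 0 + ∑[ i < k ] (F (suc i) + G (suc i))  ≡⟨ cong (F 0 + G 0 +_) (∑<-distrib-+ k (F ∘ suc) (G ∘ suc)) ⟩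
  F 0 + G 0 + (∑< k (F ∘ suc) + ∑< k (G ∘ suc))   ≡⟨ interchange (F 0) (G 0) _ _ ⟩
  F 0 + ∑< k (F ∘ suc) + (G 0 + ∑< k (G ∘ suc))   ∎
  where open ≡-Reasoning

∑<-distribˡ-* : ∀ k a (F : ℕ → ℕ) → ∑[ i < k ] (a * F i) ≡ a * ∑< k F
∑<-distribˡ-* zero    a F = sym (*-zeroʳ a)
∑<-distribˡ-* (suc k) a F =
  trans (cong (a * F 0 +_) (∑<-distribˡ-* k a (F ∘ suc))) (sym (*-distribˡ-+ a (F 0) _))

∑<-distribʳ-* : ∀ k a (F : ℕ → ℕ) → ∑[ i < k ] (F i * a) ≡ ∑< k F * a
∑<-distribʳ-* k a F =
  trans (∑<-cong k (λ i _ → *-comm (F i) a)) (trans (∑<-distribˡ-* k a F) (*-comm a (∑< k F)))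

∑<-zero : ∀ k (F : ℕ → ℕ) → (∀ i → i < k → F i ≡ 0) → ∑< k F ≡ 0
∑<-zero zero    F F≡0 = refl
∑<-zero (suc k) F F≡0 = cong₂ _+_ (F≡0 0 z<s) (∑<-zero k (F ∘ suc) (λ i i<k → F≡0 (suc i) (s<s i<k)))

-- The recursion for q and bounds on σ

private
  ∑<-zipWith : ∀ k (h g f e : ℕ → ℕ) →
    sum (zipWith _*_ (map h (applyUpTo f k)) (map g (applyUpTo e k))) ≡ ∑[ i < k ] (h (f i) * g (e i))
  ∑<-zipWith zero    h g f e = refl
  ∑<-zipWith (suc k) h g f e = cong (h (f 0) * g (e 0) +_) (∑<-zipWith k h g (f ∘ suc) (e ∘ suc))

  qList≡map-q : ∀ d n → qList d n ≡ map (q d) (applyUpTo (n ∸_) (suc n))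
  qList≡map-q d zero    = refl
  qList≡map-q d (suc n) = cong (q d (suc n) ∷_) (qList≡map-q d n)

q-suc : ∀ d n → q d (suc n) ≡ ∑[ i < suc n ] (σ d (suc i) * q d (n ∸ i))
q-suc d n = trans
  (cong₂ (λ ℓs qs → sum (zipWith _*_ (map (σ d) ℓs) qs)) (map-upTo suc (suc n)) (qList≡map-q d n))
  (∑<-zipWith (suc n) (σ d) (q d) suc (n ∸_))

^-distribʳ-* : ∀ a b d → (a * b) ^ d ≡ a ^ d * b ^ d
^-distribʳ-* a b zero    = refl
^-distribʳ-* a b (suc d) = trans (cong (a * b *_) (^-distribʳ-* a b d)) (lemma a b (a ^ d) (b ^ d))
  where
  lemma : ∀ a b x y → a * b * (x * y) ≡ a * x * (b * y)
  lemma = solve-∀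

*-^-cong : ∀ d {a b e f} → a * b ≡ e * f → a ^ d * b ^ d ≡ e ^ d * f ^ d
*-^-cong d {a} {b} {e} {f} ab≡ef = trans (sym (^-distribʳ-* a b d)) (trans (cong (_^ d) ab≡ef) (^-distribʳ-* e f d))

*-^-cong₃ : ∀ d {a b c e f g} → a * (b * c) ≡ e * (f * g) → a ^ d * (b ^ d * c ^ d) ≡ e ^ d * (f ^ d * g ^ d)
*-^-cong₃ d {a} {b} {c} {e} {f} {g} eq = begin
  a ^ d * (b ^ d * c ^ d)   ≡⟨ cong (a ^ d *_) (^-distribʳ-* b c d) ⟨
  a ^ d * (b * c) ^ d       ≡⟨ *-^-cong d eq ⟩
  e ^ d * (f * g) ^ d       ≡⟨ cong (e ^ d *_) (^-distribʳ-* f g d) ⟩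
  e ^ d * (f ^ d * g ^ d)   ∎
  where open ≡-Reasoning

proper-divisor⇒2*≤ : ∀ {ℓ m} → ℓ ∣ m → ℓ < m → 2 * ℓ ≤ m
proper-divisor⇒2*≤ {ℓ} (divides zero          refl) ()
proper-divisor⇒2*≤ {ℓ} (divides (suc zero)    refl) ℓ<ℓ+0 = ⊥-elim (<-irrefl (sym (+-identityʳ ℓ)) ℓ<ℓ+0)
proper-divisor⇒2*≤ {ℓ} (divides (suc (suc k)) refl) _ = *-monoˡ-≤ ℓ {2} {2 + k} (s≤s (s≤s z≤n))

divisorPowerSum : ℕ → ℕ → ℕ → ℕ
divisorPowerSum d m k = sum (map (_^ d) (filter (_∣? m) (oneTo k)))

private
  powerIfDivides : ℕ → ℕ → ℕ → ℕ
  powerIfDivides d m ℓ = sum (map (_^ d) (filter (_∣? m) [ ℓ ]))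

divisorPowerSum-suc : ∀ d m k → divisorPowerSum d m (suc k) ≡ divisorPowerSum d m k + powerIfDivides d m (suc k)
divisorPowerSum-suc d m k = begin
  sum (map (_^ d) (filter (_∣? m) (oneTo (suc k))))
    ≡⟨ cong (sum ∘ map (_^ d) ∘ filter (_∣? m)) oneTo-suc ⟩
  sum (map (_^ d) (filter (_∣? m) (oneTo k ++ [ suc k ])))
    ≡⟨ cong (sum ∘ map (_^ d)) (filter-++ (_∣? m) (oneTo k) [ suc k ]) ⟩
  sum (map (_^ d) (filter (_∣? m) (oneTo k) ++ filter (_∣? m) [ suc k ]))
    ≡⟨ cong sum (map-++ (_^ d) (filter (_∣? m) (oneTo k)) _) ⟩
  sum (map (_^ d) (filter (_∣? m) (oneTo k)) ++ map (_^ d) (filter (_∣? m) [ suc k ]))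
    ≡⟨ sum-++ (map (_^ d) (filter (_∣? m) (oneTo k))) _ ⟩
  divisorPowerSum d m k + powerIfDivides d m (suc k) ∎
  where
  open ≡-Reasoning
  oneTo-suc : oneTo (suc k) ≡ oneTo k ++ [ suc k ]
  oneTo-suc = trans (cong (map suc) (sym (upTo-∷ʳ k))) (map-++ suc (upTo k) [ k ])

σ-suc : ∀ d n → σ d (suc n) ≡ divisorPowerSum d (suc n) n + suc n ^ d
σ-suc d n = begin
  σ d (suc n)                                                ≡⟨ divisorPowerSum-suc d (suc n) n ⟩
  divisorPowerSum d (suc n) n + powerIfDivides d (suc n) (suc n)
    ≡⟨ cong (λ ℓs → divisorPowerSum d (suc n) n + sum (map (_^ d) ℓs)) (filter-accept (_∣? suc n) ∣-refl) ⟩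
  divisorPowerSum d (suc n) n + (suc n ^ d + 0)              ≡⟨ cong (divisorPowerSum d (suc n) n +_) (+-identityʳ _) ⟩
  divisorPowerSum d (suc n) n + suc n ^ d                    ∎
  where open ≡-Reasoning

2^*powerIfDivides≤ : ∀ d m k → suc k < m → 2 ^ d * powerIfDivides d m (suc k) ≤ m ^ d
2^*powerIfDivides≤ d m k 1+k<m with suc k ∣? m
... | yes k∣m = begin
  2 ^ d * powerIfDivides d m (suc k) ≡⟨ cong (λ ℓs → 2 ^ d * sum (map (_^ d) ℓs)) (filter-accept (_∣? m) k∣m) ⟩
  2 ^ d * (suc k ^ d + 0)            ≡⟨ cong (2 ^ d *_) (+-identityʳ _) ⟩
  2 ^ d * suc k ^ d                  ≡⟨ ^-distribʳ-* 2 (suc k) d ⟨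
  (2 * suc k) ^ d                    ≤⟨ ^-monoˡ-≤ d (proper-divisor⇒2*≤ k∣m 1+k<m) ⟩
  m ^ d                              ∎
  where open ≤-Reasoning
... | no k∤m = begin
  2 ^ d * powerIfDivides d m (suc k) ≡⟨ cong (λ ℓs → 2 ^ d * sum (map (_^ d) ℓs)) (filter-reject (_∣? m) k∤m) ⟩
  2 ^ d * 0                          ≡⟨ *-zeroʳ (2 ^ d) ⟩
  0                                  ≤⟨ z≤n ⟩
  m ^ d                              ∎
  where open ≤-Reasoning

2^*divisorPowerSum≤ : ∀ d n k → k ≤ n → 2 ^ d * divisorPowerSum d (suc n) k ≤ k * suc n ^ d
2^*divisorPowerSum≤ d n zero    _   = ≤-reflexive (*-zeroʳ (2 ^ d))
2^*divisorPowerSum≤ d n (suc k) 1+k≤n = begin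
  2 ^ d * divisorPowerSum d (suc n) (suc k)
    ≡⟨ cong (2 ^ d *_) (divisorPowerSum-suc d (suc n) k) ⟩
  2 ^ d * (divisorPowerSum d (suc n) k + powerIfDivides d (suc n) (suc k))
    ≡⟨ *-distribˡ-+ (2 ^ d) _ _ ⟩
  2 ^ d * divisorPowerSum d (suc n) k + 2 ^ d * powerIfDivides d (suc n) (suc k)
    ≤⟨ +-mono-≤ (2^*divisorPowerSum≤ d n k (<⇒≤ 1+k≤n)) (2^*powerIfDivides≤ d (suc n) k (s≤s 1+k≤n)) ⟩
  k * suc n ^ d + suc n ^ d
    ≡⟨ +-comm (k * suc n ^ d) _ ⟩
  suc k * suc n ^ d ∎
  where open ≤-Reasoning

^≤σ : ∀ d n → suc n ^ d ≤ σ d (suc n)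
^≤σ d n = subst (suc n ^ d ≤_) (sym (σ-suc d n)) (m≤n+m _ _)

2^*σ≤ : ∀ d n → 2 ^ d * σ d (suc n) ≤ 2 ^ d * suc n ^ d + n * suc n ^ d
2^*σ≤ d n = begin
  2 ^ d * σ d (suc n)                                        ≡⟨ cong (2 ^ d *_) (σ-suc d n) ⟩
  2 ^ d * (divisorPowerSum d (suc n) n + suc n ^ d)          ≡⟨ *-distribˡ-+ (2 ^ d) _ _ ⟩
  2 ^ d * divisorPowerSum d (suc n) n + 2 ^ d * suc n ^ d    ≤⟨ +-monoˡ-≤ _ (2^*divisorPowerSum≤ d n n ≤-refl) ⟩
  n * suc n ^ d + 2 ^ d * suc n ^ d                          ≡⟨ +-comm (n * suc n ^ d) _ ⟩
  2 ^ d * suc n ^ d + n * suc n ^ d                          ∎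
  where open ≤-Reasoning

-- Maximal products of compositions

-- The largest product of the parts of a composition of m; for m ≥ 2 the parts are 3s and, when 3 ∤ m,
-- one 2 or 4.
maxProd : ℕ → ℕ
maxProd 0 = 1
maxProd 1 = 1
maxProd 2 = 2
maxProd 3 = 3
maxProd 4 = 4
maxProd (suc (suc (suc (suc (suc m))))) = 3 * maxProd (suc (suc m))

maxProd-3k : ∀ k → maxProd (k * 3) ≡ 3 ^ k
maxProd-3k zero          = refl
maxProd-3k (suc zero)    = refl
maxProd-3k (suc (suc k)) = cong (3 *_) (maxProd-3k (suc k))

maxProd-2+3k : ∀ k → maxProd (2 + k * 3) ≡ 2 * 3 ^ k
maxProd-2+3k zero    = refl
maxProd-2+3k (suc k) = trans (cong (3 *_) (maxProd-2+3k k)) (x*[y*z]≡y*[x*z] 3 2 (3 ^ k))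

maxProd-4+3k : ∀ k → maxProd (4 + k * 3) ≡ 4 * 3 ^ k
maxProd-4+3k zero    = refl
maxProd-4+3k (suc k) = trans (cong (3 *_) (maxProd-4+3k k)) (x*[y*z]≡y*[x*z] 3 4 (3 ^ k))

maxProd-+3 : ∀ j r → maxProd (j + (5 + r)) ≡ 3 * maxProd (j + (2 + r))
maxProd-+3 j r = trans (cong maxProd (x+[y+z]≡y+[x+z] j 5 r)) (cong ((3 *_) ∘ maxProd) (x+[y+z]≡y+[x+z] 2 j r))

maxProd-pos : ∀ m → 0 < maxProd m
maxProd-pos 0 = z<s
maxProd-pos 1 = z<s
maxProd-pos 2 = z<s
maxProd-pos 3 = z<s
maxProd-pos 4 = z<s
maxProd-pos (suc (suc (suc (suc (suc m))))) = ≤-trans (maxProd-pos (suc (suc m))) (m≤n*m _ 3)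

maxProd-<-suc : ∀ m → maxProd (suc m) < maxProd (2 + m)
maxProd-<-suc 0 = ≤ᵇ⇒≤ _ _ _
maxProd-<-suc 1 = ≤ᵇ⇒≤ _ _ _
maxProd-<-suc 2 = ≤ᵇ⇒≤ _ _ _
maxProd-<-suc 3 = ≤ᵇ⇒≤ _ _ _
maxProd-<-suc (suc (suc (suc (suc m)))) = *-monoʳ-< 3 (maxProd-<-suc (suc m))

maxProd-mono-suc : ∀ m → maxProd m ≤ maxProd (suc m)
maxProd-mono-suc zero    = ≤-refl
maxProd-mono-suc (suc m) = <⇒≤ (maxProd-<-suc m)

2*maxProd≤ : ∀ m → 2 * maxProd m ≤ maxProd (2 + m)
2*maxProd≤ 0 = ≤ᵇ⇒≤ _ _ _
2*maxProd≤ 1 = ≤ᵇ⇒≤ _ _ _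
2*maxProd≤ 2 = ≤ᵇ⇒≤ _ _ _
2*maxProd≤ 3 = ≤ᵇ⇒≤ _ _ _
2*maxProd≤ 4 = ≤ᵇ⇒≤ _ _ _
2*maxProd≤ (suc (suc (suc (suc (suc m))))) =
  ≤-trans (≤-reflexive (x*[y*z]≡y*[x*z] 2 3 (maxProd (2 + m)))) (*-monoʳ-≤ 3 (2*maxProd≤ (suc (suc m))))

3*maxProd≤ : ∀ m → 3 * maxProd m ≤ maxProd (3 + m)
3*maxProd≤ 0 = ≤-refl
3*maxProd≤ 1 = ≤ᵇ⇒≤ _ _ _
3*maxProd≤ (suc (suc m)) = ≤-refl

4*maxProd≤ : ∀ m → 4 * maxProd m ≤ maxProd (4 + m)
4*maxProd≤ m = begin
  4 * maxProd m         ≡⟨ *-assoc 2 2 (maxProd m) ⟩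
  2 * (2 * maxProd m)   ≤⟨ *-monoʳ-≤ 2 (2*maxProd≤ m) ⟩
  2 * maxProd (2 + m)   ≤⟨ 2*maxProd≤ (2 + m) ⟩
  maxProd (4 + m)       ∎
  where open ≤-Reasoning

maxProd-supermultiplicative : ∀ a b → maxProd a * maxProd b ≤ maxProd (a + b)
maxProd-supermultiplicative 0 b = ≤-reflexive (+-identityʳ (maxProd b))
maxProd-supermultiplicative 1 b = ≤-trans (≤-reflexive (+-identityʳ (maxProd b))) (maxProd-mono-suc b)
maxProd-supermultiplicative 2 b = 2*maxProd≤ b
maxProd-supermultiplicative 3 b = 3*maxProd≤ b
maxProd-supermultiplicative 4 b = 4*maxProd≤ b
maxProd-supermultiplicative (suc (suc (suc (suc (suc a))))) b =
  ≤-trans (≤-reflexive (*-assoc 3 (maxProd (2 + a)) (maxProd b)))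
          (*-monoʳ-≤ 3 (maxProd-supermultiplicative (suc (suc a)) b))

9*≤8*maxProd : ∀ j → 9 * (5 + j) ≤ 8 * maxProd (5 + j)
9*≤8*maxProd 0 = ≤ᵇ⇒≤ _ _ _
9*≤8*maxProd 1 = ≤ᵇ⇒≤ _ _ _
9*≤8*maxProd 2 = ≤ᵇ⇒≤ _ _ _
9*≤8*maxProd (suc (suc (suc j))) = begin
  9 * (8 + j)              ≤⟨ m≤m+n (9 * (8 + j)) (63 + 18 * j) ⟩
  9 * (8 + j) + (63 + 18 * j) ≡⟨ lemma j ⟩
  3 * (9 * (5 + j))        ≤⟨ *-monoʳ-≤ 3 (9*≤8*maxProd j) ⟩
  3 * (8 * maxProd (5 + j)) ≡⟨ x*[y*z]≡y*[x*z] 3 8 (maxProd (5 + j)) ⟩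
  8 * maxProd (8 + j)      ∎
  where
  open ≤-Reasoning
  lemma : ∀ j → 9 * (8 + j) + (63 + 18 * j) ≡ 3 * (9 * (5 + j))
  lemma = solve-∀

-- A composition of j + r starting with the part j has product at most j · maxProd r; the part j is
-- tight if this is still maximal, and leaves a gap if it falls short by a factor of at least 9/8.
Tight : ℕ → ℕ → Set
Tight j r = j * maxProd r ≡ maxProd (j + r)

Gap : ℕ → ℕ → Set
Gap j r = 9 * (j * maxProd r) ≤ 8 * maxProd (j + r)

Tight? : ∀ j r → Dec (Tight j r)
Tight? j r = j * maxProd r ≟ maxProd (j + r)

Gap? : ∀ j r → Dec (Gap j r)
Gap? j r = 9 * (j * maxProd r) ≤? 8 * maxProd (j + r)

tight : ℕ → ℕ → Bool
tight j r = does (Tight? j r)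

Gap⇒¬Tight : ∀ {j r} → Gap j r → ¬ Tight j r
Gap⇒¬Tight {j} {r} gap tight = <-irrefl refl (begin-strict
  8 * maxProd (j + r)                        <⟨ +-monoˡ-< _ (maxProd-pos (j + r)) ⟩
  maxProd (j + r) + 8 * maxProd (j + r)      ≡⟨ cong (9 *_) tight ⟨
  9 * (j * maxProd r)                        ≤⟨ gap ⟩
  8 * maxProd (j + r)                        ∎)
  where open ≤-Reasoning

1-not-tight : ∀ r → ¬ Tight 1 (suc r)
1-not-tight r tight = <-irrefl (trans (sym (+-identityʳ _)) tight) (maxProd-<-suc r)

large-gap : ∀ j r → Gap (5 + j) r
large-gap j r = begin
  9 * ((5 + j) * maxProd r)       ≡⟨ *-assoc 9 (5 + j) (maxProd r) ⟨
  9 * (5 + j) * maxProd r         ≤⟨ *-monoˡ-≤ (maxProd r) (9*≤8*maxProd j) ⟩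
  8 * maxProd (5 + j) * maxProd r ≡⟨ *-assoc 8 (maxProd (5 + j)) (maxProd r) ⟩
  8 * (maxProd (5 + j) * maxProd r) ≤⟨ *-monoʳ-≤ 8 (maxProd-supermultiplicative (5 + j) r) ⟩
  8 * maxProd (5 + j + r)         ∎
  where open ≤-Reasoning

Tight-+3 : ∀ {j} r → Tight j (5 + r) ⇔ Tight j (2 + r)
Tight-+3 {j} r = mk⇔
  (λ t → *-cancelˡ-≡ _ _ 3 (trans (sym (x*[y*z]≡y*[x*z] j 3 _)) (trans t (maxProd-+3 j r))))
  (λ t → trans (x*[y*z]≡y*[x*z] j 3 _) (trans (cong (3 *_) t) (sym (maxProd-+3 j r))))

Gap-+3 : ∀ {j} r → Gap j (2 + r) → Gap j (5 + r)
Gap-+3 {j} r gap = begin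
  9 * (j * (3 * maxProd (2 + r)))   ≡⟨ lemma 9 j 3 _ ⟩
  3 * (9 * (j * maxProd (2 + r)))   ≤⟨ *-monoʳ-≤ 3 gap ⟩
  3 * (8 * maxProd (j + (2 + r)))   ≡⟨ x*[y*z]≡y*[x*z] 3 8 (maxProd (j + (2 + r))) ⟩
  8 * (3 * maxProd (j + (2 + r)))   ≡⟨ cong (8 *_) (maxProd-+3 j r) ⟨
  8 * maxProd (j + (5 + r))         ∎
  where
  open ≤-Reasoning
  lemma : ∀ a b c x → a * (b * (c * x)) ≡ c * (a * (b * x))
  lemma = solve-∀

tight-+3 : ∀ j r → tight j (5 + r) ≡ tight j (2 + r)
tight-+3 j r = does-⇔ (Tight-+3 {j} r) (Tight? j (5 + r)) (Tight? j (2 + r))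

tight-periodic : ∀ j r k → tight j (2 + r + k * 3) ≡ tight j (2 + r)
tight-periodic j r zero    = cong (tight j) (+-identityʳ (2 + r))
tight-periodic j r (suc k) = begin
  tight j (2 + r + (3 + k * 3))   ≡⟨ cong (tight j) (lemma r (k * 3)) ⟩
  tight j (5 + (r + k * 3))       ≡⟨ tight-+3 j (r + k * 3) ⟩
  tight j (2 + (r + k * 3))       ≡⟨ cong (tight j) (+-assoc 2 r (k * 3)) ⟨
  tight j (2 + r + k * 3)         ≡⟨ tight-periodic j r k ⟩
  tight j (2 + r)                 ∎
  where
  open ≡-Reasoning
  lemma : ∀ r x → 2 + r + (3 + x) ≡ 5 + (r + x)
  lemma = solve-∀

private
  tight-or-gap-finite : ∀ {j r} → 0 < j → j < 5 → r < 5 → Tight j r ⊎ Gap j r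
  tight-or-gap-finite 0<j j<5 r<5 =
    toWitness {a? = allUpTo? (λ j → allUpTo? (λ r → (0 <? j) →-dec (Tight? j r ⊎-dec Gap? j r)) 5) 5} _
      j<5 r<5 0<j

  small-part-tight-or-gap : ∀ {j} → 0 < j → j < 5 → ∀ r → Tight j r ⊎ Gap j r
  small-part-tight-or-gap 0<j j<5 0 = tight-or-gap-finite 0<j j<5 (≤ᵇ⇒≤ _ _ _)
  small-part-tight-or-gap 0<j j<5 1 = tight-or-gap-finite 0<j j<5 (≤ᵇ⇒≤ _ _ _)
  small-part-tight-or-gap 0<j j<5 2 = tight-or-gap-finite 0<j j<5 (≤ᵇ⇒≤ _ _ _)
  small-part-tight-or-gap 0<j j<5 3 = tight-or-gap-finite 0<j j<5 (≤ᵇ⇒≤ _ _ _)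
  small-part-tight-or-gap 0<j j<5 4 = tight-or-gap-finite 0<j j<5 (≤ᵇ⇒≤ _ _ _)
  small-part-tight-or-gap {j} 0<j j<5 (suc (suc (suc (suc (suc r))))) =
    Sum.map (Equivalence.from (Tight-+3 {j} r)) (Gap-+3 {j} r) (small-part-tight-or-gap 0<j j<5 (suc (suc r)))

tight-or-gap : ∀ j r → 0 < j → Tight j r ⊎ Gap j r
tight-or-gap j r 0<j with j <? 5
... | yes j<5 = small-part-tight-or-gap 0<j j<5 r
... | no  j≮5 = subst (λ j → Tight j r ⊎ Gap j r) (m+[n∸m]≡n (≮⇒≥ j≮5)) (inj₂ (large-gap (j ∸ 5) r))

tight-true : ∀ {j r} → Tight j r → tight j r ≡ true
tight-true {j} {r} = dec-true (Tight? j r)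

tight-false : ∀ {j r} → Gap j r → tight j r ≡ false
tight-false {j} {r} gap = dec-false (Tight? j r) (Gap⇒¬Tight {j} {r} gap)

∑<-tight-parts : ∀ p (G : ℕ → ℕ) →
  ∑[ i < 5 + p ] (if tight (suc i) ((4 + p) ∸ i) then G i else 0) ≡
  (if tight 2 (3 + p) then G 1 else 0) + ((if tight 3 (2 + p) then G 2 else 0) + (if tight 4 (1 + p) then G 3 else 0))
∑<-tight-parts p G = begin
  F 0 + (F 1 + (F 2 + (F 3 + ∑[ i < suc p ] F (4 + i))))
    ≡⟨ cong₂ (λ a b → a + (F 1 + (F 2 + (F 3 + b)))) first-part-not-tight large-parts-not-tight ⟩
  F 1 + (F 2 + (F 3 + 0))
    ≡⟨ cong (λ b → F 1 + (F 2 + b)) (+-identityʳ (F 3)) ⟩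
  F 1 + (F 2 + F 3) ∎
  where
  open ≡-Reasoning
  F : ℕ → ℕ
  F i = if tight (suc i) ((4 + p) ∸ i) then G i else 0
  first-part-not-tight : F 0 ≡ 0
  first-part-not-tight = cong (λ b → if b then G 0 else 0) (dec-false (Tight? 1 (4 + p)) (1-not-tight (3 + p)))
  large-parts-not-tight : ∑[ i < suc p ] F (4 + i) ≡ 0
  large-parts-not-tight = ∑<-zero (suc p) (F ∘ (4 +_)) λ i _ →
    cong (λ b → if b then G (4 + i) else 0) (tight-false {5 + i} {p ∸ i} (large-gap i (p ∸ i)))

-- Counting maximal compositions

-- The number of compositions of m with product maxProd m, counted by their first part, which must be
-- tight; for m ≥ 5 only the parts 2, 3 and 4 can be (maxCount-suc checks this against every part).
maxCount : ℕ → ℕ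
maxCount 0 = 1
maxCount 1 = 1
maxCount 2 = 1
maxCount 3 = 1
maxCount 4 = 2
maxCount (suc (suc (suc (suc (suc p))))) =
  (if tight 2 (3 + p) then maxCount (suc (suc (suc p))) else 0) +
  ((if tight 3 (2 + p) then maxCount (suc (suc p)) else 0) +
   (if tight 4 (1 + p) then maxCount (suc p) else 0))

maxCount-suc : ∀ n → maxCount (suc n) ≡ ∑[ i < suc n ] (if tight (suc i) (n ∸ i) then maxCount (n ∸ i) else 0)
maxCount-suc 0 = refl
maxCount-suc 1 = refl
maxCount-suc 2 = refl
maxCount-suc 3 = refl
maxCount-suc (suc (suc (suc (suc p)))) = sym (∑<-tight-parts p (λ i → maxCount ((4 + p) ∸ i)))

maxCount-3+3k : ∀ k → maxCount (3 + k * 3) ≡ 1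
maxCount-3+3k zero = refl
maxCount-3+3k (suc k)
  rewrite tight-periodic 2 2 k | tight-periodic 3 1 k | tight-periodic 4 0 k = trans (+-identityʳ _) (maxCount-3+3k k)

tight-4-1+3k : ∀ k → tight 4 (1 + k * 3) ≡ false
tight-4-1+3k zero    = refl
tight-4-1+3k (suc k) = tight-periodic 4 2 k

maxCount-2+3k : ∀ k → maxCount (2 + k * 3) ≡ suc k
maxCount-2+3k zero = refl
maxCount-2+3k (suc k)
  rewrite tight-periodic 2 1 k | tight-periodic 3 0 k | tight-4-1+3k k
        | maxCount-3+3k k | maxCount-2+3k k = cong suc (+-identityʳ (suc k))

maxCount-4+3k : ∀ k → 2 * maxCount (4 + k * 3) ≡ (k + 1) * (k + 4)
maxCount-4+3k zero = refl
maxCount-4+3k (suc k)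
  rewrite tight-periodic 2 3 k | tight-periodic 3 2 k | tight-periodic 4 1 k = begin
  2 * (maxCount (5 + k * 3) + (maxCount (4 + k * 3) + maxCount (3 + k * 3)))
    ≡⟨ cong₂ (λ a b → 2 * (a + (maxCount (4 + k * 3) + b))) (maxCount-2+3k (suc k)) (maxCount-3+3k k) ⟩
  2 * (2 + k + (maxCount (4 + k * 3) + 1))   ≡⟨ lemma k (maxCount (4 + k * 3)) ⟩
  2 * maxCount (4 + k * 3) + (2 * k + 6)     ≡⟨ cong (_+ (2 * k + 6)) (maxCount-4+3k k) ⟩
  (k + 1) * (k + 4) + (2 * k + 6)            ≡⟨ lemma′ k ⟩
  (suc k + 1) * (suc k + 4)                  ∎
  where
  open ≡-Reasoning
  lemma : ∀ k x → 2 * (2 + k + (x + 1)) ≡ 2 * x + (2 * k + 6)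
  lemma = solve-∀
  lemma′ : ∀ k → (k + 1) * (k + 4) + (2 * k + 6) ≡ (suc k + 1) * (suc k + 4)
  lemma′ = solve-∀

if-then-else-0≤ : ∀ b x → (if b then x else 0) ≤ x
if-then-else-0≤ true  x = ≤-refl
if-then-else-0≤ false x = z≤n

maxCount≤2^ : ∀ m → maxCount m ≤ 2 ^ m
maxCount≤2^ 0 = ≤-refl
maxCount≤2^ 1 = ≤ᵇ⇒≤ _ _ _
maxCount≤2^ 2 = ≤ᵇ⇒≤ _ _ _
maxCount≤2^ 3 = ≤ᵇ⇒≤ _ _ _
maxCount≤2^ 4 = ≤ᵇ⇒≤ _ _ _
maxCount≤2^ (suc (suc (suc (suc (suc p))))) = begin
  maxCount (5 + p)
    ≤⟨ +-mono-≤ (≤-trans (if-then-else-0≤ (tight 2 (3 + p)) _) (maxCount≤2^ (suc (suc (suc p)))))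
                (+-mono-≤ (≤-trans (if-then-else-0≤ (tight 3 (2 + p)) _) (maxCount≤2^ (suc (suc p))))
                          (≤-trans (if-then-else-0≤ (tight 4 (1 + p)) _) (maxCount≤2^ (suc p)))) ⟩
  2 ^ (3 + p) + (2 ^ (2 + p) + 2 ^ (1 + p))            ≤⟨ m≤m+n _ (18 * 2 ^ p) ⟩
  2 ^ (3 + p) + (2 ^ (2 + p) + 2 ^ (1 + p)) + 18 * 2 ^ p ≡⟨ lemma (2 ^ p) ⟩
  2 ^ (5 + p)                                          ∎
  where
  open ≤-Reasoning
  lemma : ∀ x → 2 * (2 * (2 * x)) + (2 * (2 * x) + 2 * x) + 18 * x ≡ 2 * (2 * (2 * (2 * (2 * x))))
  lemma = solve-∀

maxCount+1≤2^ : ∀ m → maxCount m + 1 ≤ 2 ^ suc m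
maxCount+1≤2^ m = begin
  maxCount m + 1        ≤⟨ +-mono-≤ (maxCount≤2^ m) (m^n>0 2 m) ⟩
  2 ^ m + 2 ^ m         ≡⟨ cong (2 ^ m +_) (+-identityʳ (2 ^ m)) ⟨
  2 ^ suc m             ∎
  where open ≤-Reasoning

-- Bounds on q

Tight⇒^ : ∀ {j r} d → Tight j r → j ^ d * maxProd r ^ d ≡ maxProd (j + r) ^ d
Tight⇒^ {j} {r} d t = trans (sym (^-distribʳ-* j (maxProd r) d)) (cong (_^ d) t)

Gap⇒^ : ∀ {j r} d → Gap j r → 9 ^ d * (j ^ d * maxProd r ^ d) ≤ 8 ^ d * maxProd (j + r) ^ d
Gap⇒^ {j} {r} d gap = begin
  9 ^ d * (j ^ d * maxProd r ^ d)   ≡⟨ cong (9 ^ d *_) (^-distribʳ-* j (maxProd r) d) ⟨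
  9 ^ d * (j * maxProd r) ^ d       ≡⟨ ^-distribʳ-* 9 _ d ⟨
  (9 * (j * maxProd r)) ^ d         ≤⟨ ^-monoˡ-≤ d gap ⟩
  (8 * maxProd (j + r)) ^ d         ≡⟨ ^-distribʳ-* 8 _ d ⟩
  8 ^ d * maxProd (j + r) ^ d       ∎
  where open ≤-Reasoning

first-part-split : ∀ {i n} → i ≤ n → suc i + (n ∸ i) ≡ suc n
first-part-split i≤n = cong suc (m+[n∸m]≡n i≤n)

q-lower-bound : ∀ d m → maxCount m * maxProd m ^ d ≤ q d m
q-lower-bound d = <-rec _ step
  where
  step : ∀ m → (∀ {r} → r < m → maxCount r * maxProd r ^ d ≤ q d r) → maxCount m * maxProd m ^ d ≤ q d m
  step zero    _  = ≤-reflexive (trans (+-identityʳ _) (^-zeroˡ d))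
  step (suc n) IH = begin
    maxCount (suc n) * maxProd (suc n) ^ d                 ≡⟨ cong (_* maxProd (suc n) ^ d) (maxCount-suc n) ⟩
    ∑< (suc n) F * maxProd (suc n) ^ d                     ≡⟨ ∑<-distribʳ-* (suc n) _ F ⟨
    ∑[ i < suc n ] (F i * maxProd (suc n) ^ d)             ≤⟨ ∑<-mono-≤ (suc n) term ⟩
    ∑[ i < suc n ] (σ d (suc i) * q d (n ∸ i))             ≡⟨ q-suc d n ⟨
    q d (suc n)                                            ∎
    where
    open ≤-Reasoning
    F : ℕ → ℕ
    F i = if tight (suc i) (n ∸ i) then maxCount (n ∸ i) else 0
    term : ∀ i → i < suc n → F i * maxProd (suc n) ^ d ≤ σ d (suc i) * q d (n ∸ i)
    term i (s≤s i≤n) with tight-or-gap (suc i) (n ∸ i) z<s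
    ... | inj₂ gap rewrite tight-false {suc i} {n ∸ i} gap = z≤n
    ... | inj₁ t   rewrite tight-true  {suc i} {n ∸ i} t   = begin
      maxCount r * maxProd (suc n) ^ d                      ≡⟨ cong (λ m → maxCount r * maxProd m ^ d) (first-part-split i≤n) ⟨
      maxCount r * maxProd (suc i + r) ^ d                  ≡⟨ cong (maxCount r *_) (Tight⇒^ d t) ⟨
      maxCount r * (suc i ^ d * maxProd r ^ d)              ≡⟨ x*[y*z]≡y*[x*z] (maxCount r) (suc i ^ d) (maxProd r ^ d) ⟩
      suc i ^ d * (maxCount r * maxProd r ^ d)              ≤⟨ *-mono-≤ (^≤σ d i) (IH (s≤s (m∸n≤m n i))) ⟩
      σ d (suc i) * q d r                                   ∎
      where r = n ∸ i

private
  Ac+x≤A[c+1] : ∀ A c {x} → x ≤ A → A * c + x ≤ A * (c + 1)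
  Ac+x≤A[c+1] A c x≤A = begin
    A * c + _   ≤⟨ +-monoʳ-≤ (A * c) x≤A ⟩
    A * c + A   ≡⟨ trans (+-comm (A * c) A) (sym (*-suc A c)) ⟩
    A * suc c   ≡⟨ cong (A *_) (+-comm 1 c) ⟩
    A * (c + 1) ∎
    where open ≤-Reasoning

-- The summand σ d j · q d r of q d (suc n), where j = suc i and r = n ∸ i, scaled by H = 2^d and A = 9^d;
-- here s = σ d j, J = j^d, Tr = maxProd r ^ d, Tm = maxProd (suc n) ^ d, B = 8^d, and A q ≤ (A c + B g) Tr
-- is the bound for r. The proper divisors of j add at most i J to s, which costs suc i (c + 1) in the error.
tight-summand≤ : ∀ H A B s q J c g Tr Tm i →
  H * s ≤ H * J + i * J → A * q ≤ (A * c + B * g) * Tr → B * g ≤ A → A ≤ H * B → J * Tr ≡ Tm →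
  H * (A * (s * q)) ≤ H * ((A * c + B * (g + suc i * (c + 1))) * Tm)
tight-summand≤ H A B s q J c g Tr Tm i s≤ q≤ Bg≤A A≤HB JTr≡Tm = begin
  H * (A * (s * q))                                    ≡⟨ lemma₁ H A s q ⟩
  (H * s) * (A * q)                                    ≤⟨ *-mono-≤ s≤ q≤ ⟩
  (H * J + i * J) * ((A * c + B * g) * Tr)             ≡⟨ lemma₂ H J i (A * c + B * g) Tr ⟩
  H * (A * c + B * g) * (J * Tr) + i * ((A * c + B * g) * (J * Tr))
    ≡⟨ cong (λ t → H * (A * c + B * g) * t + i * ((A * c + B * g) * t)) JTr≡Tm ⟩
  H * (A * c + B * g) * Tm + i * ((A * c + B * g) * Tm)
    ≤⟨ +-monoʳ-≤ (H * (A * c + B * g) * Tm) (*-mono-≤ (n≤1+n i) (*-monoˡ-≤ Tm Ac+Bg≤HB[c+1])) ⟩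
  H * (A * c + B * g) * Tm + suc i * (H * B * (c + 1) * Tm) ≡⟨ lemma₃ H A B c g Tm i ⟩
  H * ((A * c + B * (g + suc i * (c + 1))) * Tm)       ∎
  where
  open ≤-Reasoning
  lemma₁ : ∀ H A s q → H * (A * (s * q)) ≡ (H * s) * (A * q)
  lemma₁ = solve-∀
  lemma₂ : ∀ H J i X Tr → (H * J + i * J) * (X * Tr) ≡ H * X * (J * Tr) + i * (X * (J * Tr))
  lemma₂ = solve-∀
  lemma₃ : ∀ H A B c g Tm i →
    H * (A * c + B * g) * Tm + (1 + i) * (H * B * (c + 1) * Tm) ≡ H * ((A * c + B * (g + (1 + i) * (c + 1))) * Tm)
  lemma₃ = solve-∀
  Ac+Bg≤HB[c+1] : A * c + B * g ≤ H * B * (c + 1)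
  Ac+Bg≤HB[c+1] = ≤-trans (Ac+x≤A[c+1] A c Bg≤A) (*-monoˡ-≤ (c + 1) A≤HB)

gap-summand≤ : ∀ H A B s q J c g Tr Tm i → 0 < H →
  H * s ≤ H * J + i * J → A * q ≤ (A * c + B * g) * Tr → B * g ≤ A → A * (J * Tr) ≤ B * Tm →
  H * (A * (s * q)) ≤ H * ((A * 0 + B * (0 + suc i * (c + 1))) * Tm)
gap-summand≤ H A B s q J c g Tr Tm i 0<H s≤ q≤ Bg≤A AJTr≤BTm = begin
  H * (A * (s * q))                             ≡⟨ lemma₁ H A s q ⟩
  (H * s) * (A * q)                             ≤⟨ *-mono-≤ s≤ q≤ ⟩
  (H * J + i * J) * ((A * c + B * g) * Tr)      ≤⟨ *-monoʳ-≤ (H * J + i * J) (*-monoˡ-≤ Tr (Ac+x≤A[c+1] A c Bg≤A)) ⟩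
  (H * J + i * J) * (A * (c + 1) * Tr)          ≡⟨ lemma₂ H J i A c Tr ⟩
  (H + i) * (c + 1) * (A * (J * Tr))            ≤⟨ *-monoʳ-≤ ((H + i) * (c + 1)) AJTr≤BTm ⟩
  (H + i) * (c + 1) * (B * Tm)                  ≤⟨ *-monoˡ-≤ (B * Tm) (*-monoˡ-≤ (c + 1) H+i≤H+Hi) ⟩
  (H + H * i) * (c + 1) * (B * Tm)              ≡⟨ lemma₃ H A B c Tm i ⟩
  H * ((A * 0 + B * (0 + suc i * (c + 1))) * Tm) ∎
  where
  open ≤-Reasoning
  lemma₁ : ∀ H A s q → H * (A * (s * q)) ≡ (H * s) * (A * q)
  lemma₁ = solve-∀
  lemma₂ : ∀ H J i A c Tr → (H * J + i * J) * (A * (c + 1) * Tr) ≡ (H + i) * (c + 1) * (A * (J * Tr))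
  lemma₂ = solve-∀
  lemma₃ : ∀ H A B c Tm i → (H + H * i) * (c + 1) * (B * Tm) ≡ H * ((A * 0 + B * (0 + (1 + i) * (c + 1))) * Tm)
  lemma₃ = solve-∀
  H+i≤H+Hi : H + i ≤ H + H * i
  H+i≤H+Hi = +-monoʳ-≤ H (m≤n*m i H {{>-nonZero 0<H}})

∑<-linear*2^≤ : ∀ a k → ∑[ i < k ] ((a + i) * 2 ^ (k ∸ i)) ≤ 2 * (a + 1) * 2 ^ k
∑<-linear*2^≤ a zero    = z≤n
∑<-linear*2^≤ a (suc k) = begin
  (a + 0) * 2 ^ suc k + ∑[ i < k ] ((a + suc i) * 2 ^ (k ∸ i))
    ≡⟨ cong ((a + 0) * 2 ^ suc k +_) (∑<-cong k (λ i _ → cong (_* 2 ^ (k ∸ i)) (+-suc a i))) ⟩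
  (a + 0) * 2 ^ suc k + ∑[ i < k ] ((suc a + i) * 2 ^ (k ∸ i))
    ≤⟨ +-monoʳ-≤ ((a + 0) * 2 ^ suc k) (∑<-linear*2^≤ (suc a) k) ⟩
  (a + 0) * (2 * 2 ^ k) + 2 * (suc a + 1) * 2 ^ k
    ≡⟨ lemma a (2 ^ k) ⟩
  2 * (a + 1) * (2 * 2 ^ k) ∎
  where
  open ≤-Reasoning
  lemma : ∀ a x → (a + 0) * (2 * x) + 2 * (suc a + 1) * x ≡ 2 * (a + 1) * (2 * x)
  lemma = solve-∀

-- The weight, relative to 8^d, that the summand with first part suc i contributes to the error term in
-- the upper bound on q (suc n).
excess : ℕ → ℕ → ℕ
excess n i = (if tight (suc i) (n ∸ i) then 3 ^ (n ∸ i) else 0) + suc i * (maxCount (n ∸ i) + 1)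

∑<-excess≤3^ : ∀ n → ∑[ i < suc n ] excess n i ≤ 3 ^ suc n
∑<-excess≤3^ 0 = ≤ᵇ⇒≤ _ _ _
∑<-excess≤3^ 1 = ≤ᵇ⇒≤ _ _ _
∑<-excess≤3^ 2 = ≤ᵇ⇒≤ _ _ _
∑<-excess≤3^ 3 = ≤ᵇ⇒≤ _ _ _
∑<-excess≤3^ (suc (suc (suc (suc p)))) = begin
  ∑[ i < 5 + p ] (I i + W i)                                    ≡⟨ ∑<-distrib-+ (5 + p) I W ⟩
  ∑< (5 + p) I + ∑< (5 + p) W                                   ≡⟨ cong (_+ ∑< (5 + p) W) (∑<-tight-parts p (λ i → 3 ^ (n ∸ i))) ⟩
  (I 1 + (I 2 + I 3)) + ∑< (5 + p) W
    ≤⟨ +-mono-≤ (+-mono-≤ (if-then-else-0≤ (tight 2 (3 + p)) _)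
                          (+-mono-≤ (if-then-else-0≤ (tight 3 (2 + p)) _) (if-then-else-0≤ (tight 4 (1 + p)) _)))
                ∑<-W≤ ⟩
  3 ^ (3 + p) + (3 ^ (2 + p) + 3 ^ (1 + p)) + 4 * 2 ^ (5 + p)    ≡⟨ lemma (3 ^ p) (2 ^ p) ⟩
  39 * 3 ^ p + 128 * 2 ^ p                                      ≤⟨ +-monoʳ-≤ (39 * 3 ^ p) (*-monoʳ-≤ 128 (^-monoˡ-≤ p (≤ᵇ⇒≤ 2 3 _))) ⟩
  39 * 3 ^ p + 128 * 3 ^ p                                      ≤⟨ ≤-reflexive (sym (*-distribʳ-+ (3 ^ p) 39 128)) ⟩
  167 * 3 ^ p                                                   ≤⟨ *-monoˡ-≤ (3 ^ p) (≤ᵇ⇒≤ 167 243 _) ⟩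
  243 * 3 ^ p                                                   ≡⟨ lemma′ (3 ^ p) ⟩
  3 ^ (5 + p)                                                   ∎
  where
  open ≤-Reasoning
  n : ℕ
  n = 4 + p
  I W : ℕ → ℕ
  I i = if tight (suc i) (n ∸ i) then 3 ^ (n ∸ i) else 0
  W i = suc i * (maxCount (n ∸ i) + 1)
  ∑<-W≤ : ∑< (5 + p) W ≤ 4 * 2 ^ (5 + p)
  ∑<-W≤ = ≤-trans (∑<-mono-≤ (5 + p) W≤) (∑<-linear*2^≤ 1 (5 + p))
    where
    W≤ : ∀ i → i < 5 + p → W i ≤ (1 + i) * 2 ^ ((5 + p) ∸ i)
    W≤ i (s≤s i≤n) =
      *-monoʳ-≤ (suc i) (subst (maxCount (n ∸ i) + 1 ≤_) (cong (2 ^_) (sym (+-∸-assoc 1 i≤n))) (maxCount+1≤2^ (n ∸ i)))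
  lemma : ∀ x y → 3 * (3 * (3 * x)) + (3 * (3 * x) + 3 * x) + 4 * (2 * (2 * (2 * (2 * (2 * y))))) ≡ 39 * x + 128 * y
  lemma = solve-∀
  lemma′ : ∀ x → 243 * x ≡ 3 * (3 * (3 * (3 * (3 * x))))
  lemma′ = solve-∀

9^≤2^*8^ : ∀ d → 9 ^ d ≤ 2 ^ d * 8 ^ d
9^≤2^*8^ d = subst (9 ^ d ≤_) (^-distribʳ-* 2 8 d) (^-monoˡ-≤ d (≤ᵇ⇒≤ 9 16 _))

q-upper-bound : ∀ d N → 8 ^ d * 3 ^ N ≤ 9 ^ d → ∀ m → m ≤ N →
  9 ^ d * q d m ≤ (9 ^ d * maxCount m + 8 ^ d * 3 ^ m) * maxProd m ^ d
q-upper-bound d N 8^3^N≤9^ = <-rec _ step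
  where
  A B H : ℕ
  A = 9 ^ d
  B = 8 ^ d
  H = 2 ^ d
  B*3^≤A : ∀ {r} → r ≤ N → B * 3 ^ r ≤ A
  B*3^≤A r≤N = ≤-trans (*-monoʳ-≤ B (^-monoʳ-≤ 3 r≤N)) 8^3^N≤9^
  step : ∀ m → (∀ {r} → r < m → r ≤ N → A * q d r ≤ (A * maxCount r + B * 3 ^ r) * maxProd r ^ d) →
    m ≤ N → A * q d m ≤ (A * maxCount m + B * 3 ^ m) * maxProd m ^ d
  step zero _ _ = begin
    A * 1                      ≤⟨ m≤m+n (A * 1) (B * 1) ⟩
    A * 1 + B * 1              ≡⟨ *-identityʳ _ ⟨
    (A * 1 + B * 1) * 1        ≡⟨ cong ((A * 1 + B * 1) *_) (^-zeroˡ d) ⟨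
    (A * 1 + B * 1) * 1 ^ d    ∎
    where open ≤-Reasoning
  step (suc n) IH 1+n≤N = *-cancelˡ-≤ H {{m^n≢0 2 d}} (begin
    H * (A * q d (suc n))                    ≡⟨ cong (λ t → H * (A * t)) (q-suc d n) ⟩
    H * (A * ∑< (suc n) F)                   ≡⟨ trans (∑<-distribˡ-* (suc n) H (λ i → A * F i)) (cong (H *_) (∑<-distribˡ-* (suc n) A F)) ⟨
    ∑[ i < suc n ] (H * (A * F i))           ≤⟨ ∑<-mono-≤ (suc n) summand≤ ⟩
    ∑[ i < suc n ] (H * (R i * Tm))          ≡⟨ trans (∑<-distribˡ-* (suc n) H (λ i → R i * Tm)) (cong (H *_) (∑<-distribʳ-* (suc n) Tm R)) ⟩
    H * (∑< (suc n) R * Tm)                  ≡⟨ cong (λ t → H * (t * Tm)) ∑<-R ⟩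
    H * ((A * maxCount (suc n) + B * ∑[ i < suc n ] excess n i) * Tm)
      ≤⟨ *-monoʳ-≤ H (*-monoˡ-≤ Tm (+-monoʳ-≤ (A * maxCount (suc n)) (*-monoʳ-≤ B (∑<-excess≤3^ n)))) ⟩
    H * ((A * maxCount (suc n) + B * 3 ^ suc n) * Tm) ∎)
    where
    open ≤-Reasoning
    Tm : ℕ
    Tm = maxProd (suc n) ^ d
    F C R : ℕ → ℕ
    F i = σ d (suc i) * q d (n ∸ i)
    C i = if tight (suc i) (n ∸ i) then maxCount (n ∸ i) else 0
    R i = A * C i + B * excess n i
    ∑<-R : ∑< (suc n) R ≡ A * maxCount (suc n) + B * ∑[ i < suc n ] excess n i
    ∑<-R = trans (∑<-distrib-+ (suc n) (λ i → A * C i) (λ i → B * excess n i))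
      (cong₂ _+_ (trans (∑<-distribˡ-* (suc n) A C) (cong (A *_) (sym (maxCount-suc n))))
                 (∑<-distribˡ-* (suc n) B (excess n)))
    summand≤ : ∀ i → i < suc n → H * (A * F i) ≤ H * (R i * Tm)
    summand≤ i (s≤s i≤n) with tight-or-gap (suc i) (n ∸ i) z<s
    ... | inj₁ t rewrite tight-true {suc i} {n ∸ i} t =
      tight-summand≤ H A B (σ d (suc i)) (q d r) (suc i ^ d) (maxCount r) (3 ^ r) (maxProd r ^ d) Tm i
        (2^*σ≤ d i) (IH r<sn r≤N) (B*3^≤A r≤N) (9^≤2^*8^ d)
        (trans (Tight⇒^ d t) (cong (λ m → maxProd m ^ d) (first-part-split i≤n)))
      where
      r = n ∸ i
      r<sn = s≤s (m∸n≤m n i)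
      r≤N = ≤-trans (m∸n≤m n i) (<⇒≤ 1+n≤N)
    ... | inj₂ gap rewrite tight-false {suc i} {n ∸ i} gap =
      gap-summand≤ H A B (σ d (suc i)) (q d r) (suc i ^ d) (maxCount r) (3 ^ r) (maxProd r ^ d) Tm i
        (m^n>0 2 d) (2^*σ≤ d i) (IH r<sn r≤N) (B*3^≤A r≤N)
        (subst (λ m → A * (suc i ^ d * maxProd (n ∸ i) ^ d) ≤ B * maxProd m ^ d) (first-part-split i≤n) (Gap⇒^ d gap))
      where
      r = n ∸ i
      r<sn = s≤s (m∸n≤m n i)
      r≤N = ≤-trans (m∸n≤m n i) (<⇒≤ 1+n≤N)

-- The three residue classes

-- Combining the two bounds at n - 1, n, n + 1; with Tₖ = maxProd ^ d, the ratio T₀² / (T₋ T₊) is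
-- (9/8)^d, (8/9)^d or 1 according as n ≡ 0, 1 or 2 (mod 3).
ratio-9/8⇒mul≤sq : ∀ A B q₋ q₊ q₀ T₋ T₊ T₀ c₋ c₊ g₋ g₊ → 0 < A →
  A * q₋ ≤ (A * c₋ + B * g₋) * T₋ → A * q₊ ≤ (A * c₊ + B * g₊) * T₊ → B * g₋ ≤ A → B * g₊ ≤ A →
  T₀ ≤ q₀ → A * (T₋ * T₊) ≡ B * (T₀ * T₀) → (c₋ + 1) * (c₊ + 1) * B ≤ A →
  q₋ * q₊ ≤ q₀ * q₀
ratio-9/8⇒mul≤sq A B q₋ q₊ q₀ T₋ T₊ T₀ c₋ c₊ g₋ g₊ 0<A q₋≤ q₊≤ Bg₋≤A Bg₊≤A T₀≤q₀ ratio counts =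
  *-cancelˡ-≤ A (*-cancelˡ-≤ A (*-cancelˡ-≤ A (begin
    A * (A * (A * (q₋ * q₊)))                                ≡⟨ lemma₁ A q₋ q₊ ⟩
    A * ((A * q₋) * (A * q₊))                                ≤⟨ *-monoʳ-≤ A (*-mono-≤ q₋≤ q₊≤) ⟩
    A * (((A * c₋ + B * g₋) * T₋) * ((A * c₊ + B * g₊) * T₊))
      ≤⟨ *-monoʳ-≤ A (*-mono-≤ (*-monoˡ-≤ T₋ (Ac+x≤A[c+1] A c₋ Bg₋≤A)) (*-monoˡ-≤ T₊ (Ac+x≤A[c+1] A c₊ Bg₊≤A))) ⟩
    A * ((A * (c₋ + 1) * T₋) * (A * (c₊ + 1) * T₊))          ≡⟨ lemma₂ A (c₋ + 1) (c₊ + 1) T₋ T₊ ⟩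
    A * A * ((c₋ + 1) * (c₊ + 1)) * (A * (T₋ * T₊))          ≡⟨ cong (A * A * ((c₋ + 1) * (c₊ + 1)) *_) ratio ⟩
    A * A * ((c₋ + 1) * (c₊ + 1)) * (B * (T₀ * T₀))          ≡⟨ lemma₃ A B ((c₋ + 1) * (c₊ + 1)) (T₀ * T₀) ⟩
    A * A * ((c₋ + 1) * (c₊ + 1) * B) * (T₀ * T₀)            ≤⟨ *-monoˡ-≤ (T₀ * T₀) (*-monoʳ-≤ (A * A) counts) ⟩
    A * A * A * (T₀ * T₀)                                    ≤⟨ *-monoʳ-≤ (A * A * A) (*-mono-≤ T₀≤q₀ T₀≤q₀) ⟩
    A * A * A * (q₀ * q₀)                                    ≡⟨ lemma₄ A (q₀ * q₀) ⟩
    A * (A * (A * (q₀ * q₀)))                                ∎)))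
  where
  open ≤-Reasoning
  instance _ = >-nonZero 0<A
  lemma₁ : ∀ A x y → A * (A * (A * (x * y))) ≡ A * ((A * x) * (A * y))
  lemma₁ = solve-∀
  lemma₂ : ∀ A u v T₋ T₊ → A * ((A * u * T₋) * (A * v * T₊)) ≡ A * A * (u * v) * (A * (T₋ * T₊))
  lemma₂ = solve-∀
  lemma₃ : ∀ A B u T → A * A * u * (B * T) ≡ A * A * (u * B) * T
  lemma₃ = solve-∀
  lemma₄ : ∀ A x → A * A * A * x ≡ A * (A * (A * x))
  lemma₄ = solve-∀

ratio-8/9⇒sq<mul : ∀ A B q₋ q₊ q₀ T₋ T₊ T₀ c₀ g₀ → 0 < A → 0 < T₋ * T₊ →
  A * q₀ ≤ (A * c₀ + B * g₀) * T₀ → B * g₀ ≤ A → T₋ ≤ q₋ → T₊ ≤ q₊ →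
  A * (T₀ * T₀) ≡ B * (T₋ * T₊) → (c₀ + 1) * (c₀ + 1) * B < A →
  q₀ * q₀ < q₋ * q₊
ratio-8/9⇒sq<mul A B q₋ q₊ q₀ T₋ T₊ T₀ c₀ g₀ 0<A 0<T₋T₊ q₀≤ Bg₀≤A T₋≤q₋ T₊≤q₊ ratio counts =
  *-cancelˡ-< A _ _ (*-cancelˡ-< A _ _ (*-cancelˡ-< A _ _ (begin-strict
    A * (A * (A * (q₀ * q₀)))                                ≡⟨ lemma₁ A q₀ q₀ ⟩
    A * ((A * q₀) * (A * q₀))                                ≤⟨ *-monoʳ-≤ A (*-mono-≤ q₀≤ q₀≤) ⟩
    A * (((A * c₀ + B * g₀) * T₀) * ((A * c₀ + B * g₀) * T₀))
      ≤⟨ *-monoʳ-≤ A (*-mono-≤ (*-monoˡ-≤ T₀ (Ac+x≤A[c+1] A c₀ Bg₀≤A)) (*-monoˡ-≤ T₀ (Ac+x≤A[c+1] A c₀ Bg₀≤A))) ⟩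
    A * ((A * (c₀ + 1) * T₀) * (A * (c₀ + 1) * T₀))          ≡⟨ lemma₂ A (c₀ + 1) (c₀ + 1) T₀ T₀ ⟩
    A * A * ((c₀ + 1) * (c₀ + 1)) * (A * (T₀ * T₀))          ≡⟨ cong (A * A * ((c₀ + 1) * (c₀ + 1)) *_) ratio ⟩
    A * A * ((c₀ + 1) * (c₀ + 1)) * (B * (T₋ * T₊))          ≡⟨ lemma₃ A B ((c₀ + 1) * (c₀ + 1)) (T₋ * T₊) ⟩
    A * A * ((c₀ + 1) * (c₀ + 1) * B) * (T₋ * T₊)
      <⟨ *-monoˡ-< (T₋ * T₊) {{>-nonZero 0<T₋T₊}} (*-monoʳ-< (A * A) {{>-nonZero (*-mono-≤ 0<A 0<A)}} counts) ⟩
    A * A * A * (T₋ * T₊)                                    ≤⟨ *-monoʳ-≤ (A * A * A) (*-mono-≤ T₋≤q₋ T₊≤q₊) ⟩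
    A * A * A * (q₋ * q₊)                                    ≡⟨ lemma₄ A (q₋ * q₊) ⟩
    A * (A * (A * (q₋ * q₊)))                                ∎)))
  where
  open ≤-Reasoning
  lemma₁ : ∀ A x y → A * (A * (A * (x * y))) ≡ A * ((A * x) * (A * y))
  lemma₁ = solve-∀
  lemma₂ : ∀ A u v T₋ T₊ → A * ((A * u * T₋) * (A * v * T₊)) ≡ A * A * (u * v) * (A * (T₋ * T₊))
  lemma₂ = solve-∀
  lemma₃ : ∀ A B u T → A * A * u * (B * T) ≡ A * A * (u * B) * T
  lemma₃ = solve-∀
  lemma₄ : ∀ A x → A * A * A * x ≡ A * (A * (A * x))
  lemma₄ = solve-∀

-- Here the counts decide: maxCount is (k+1)(k+4)/2, k+2, 1 at n-1, n, n+1, and (k+2)² exceeds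
-- (k+1)(k+4)/2 by enough to absorb the error terms x and 9x.
ratio-1⇒mul≤sq : ∀ A q₋ q₊ q₀ T₋ T₊ T₀ c₋ c₀ x k → 0 < A →
  A * q₋ ≤ (A * c₋ + x) * T₋ → A * q₊ ≤ (A * 1 + 9 * x) * T₊ → c₀ * T₀ ≤ q₀ →
  T₀ * T₀ ≡ T₋ * T₊ → 2 * c₋ ≡ (k + 1) * (k + 4) → c₀ ≡ k + 2 → 18 * x ≤ A →
  q₋ * q₊ ≤ q₀ * q₀
ratio-1⇒mul≤sq A q₋ q₊ q₀ T₋ T₊ T₀ c₋ c₀ x k 0<A q₋≤ q₊≤ c₀T₀≤q₀ ratio c₋≡ c₀≡ 18x≤A =
  *-cancelˡ-≤ A (*-cancelˡ-≤ A (*-cancelˡ-≤ 4 (begin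
    4 * (A * (A * (q₋ * q₊)))                                ≡⟨ lemma₁ A q₋ q₊ ⟩
    4 * ((A * q₋) * (A * q₊))                                ≤⟨ *-monoʳ-≤ 4 (*-mono-≤ q₋≤ q₊≤) ⟩
    4 * (((A * c₋ + x) * T₋) * ((A * 1 + 9 * x) * T₊))      ≡⟨ lemma₂ A c₋ x T₋ T₊ ⟩
    ((A * (2 * c₋) + 2 * x) * (2 * A + 18 * x)) * (T₋ * T₊)  ≡⟨ cong (λ v → ((A * v + 2 * x) * (2 * A + 18 * x)) * (T₋ * T₊)) c₋≡ ⟩
    ((A * P + 2 * x) * (2 * A + 18 * x)) * (T₋ * T₊)
      ≤⟨ *-monoˡ-≤ (T₋ * T₊) (*-mono-≤ (+-monoʳ-≤ (A * P) 2x≤A) (+-monoʳ-≤ (2 * A) 18x≤A)) ⟩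
    ((A * P + A) * (2 * A + A)) * (T₋ * T₊)                  ≤⟨ *-monoˡ-≤ (T₋ * T₊) (m≤m+n ((A * P + A) * (2 * A + A)) (A * A * (k * k + k + 1))) ⟩
    ((A * P + A) * (2 * A + A) + A * A * (k * k + k + 1)) * (T₋ * T₊)
                                                             ≡⟨ cong (_* (T₋ * T₊)) (lemma₃ A k) ⟩
    4 * (A * (A * ((k + 2) * (k + 2)))) * (T₋ * T₊)          ≡⟨ cong₂ (λ c T → 4 * (A * (A * (c * c))) * T) c₀≡ ratio ⟨
    4 * (A * (A * (c₀ * c₀))) * (T₀ * T₀)                    ≡⟨ lemma₄ A c₀ T₀ ⟩
    4 * (A * (A * ((c₀ * T₀) * (c₀ * T₀))))                  ≤⟨ *-monoʳ-≤ 4 (*-monoʳ-≤ A (*-monoʳ-≤ A (*-mono-≤ c₀T₀≤q₀ c₀T₀≤q₀))) ⟩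
    4 * (A * (A * (q₀ * q₀)))                                ∎)))
  where
  open ≤-Reasoning
  instance _ = >-nonZero 0<A
  P = (k + 1) * (k + 4)
  2x≤A : 2 * x ≤ A
  2x≤A = ≤-trans (*-monoˡ-≤ x (≤ᵇ⇒≤ 2 18 _)) 18x≤A
  lemma₁ : ∀ A x y → 4 * (A * (A * (x * y))) ≡ 4 * ((A * x) * (A * y))
  lemma₁ = solve-∀
  lemma₂ : ∀ A c x T₋ T₊ →
    4 * (((A * c + x) * T₋) * ((A * 1 + 9 * x) * T₊)) ≡ ((A * (2 * c) + 2 * x) * (2 * A + 18 * x)) * (T₋ * T₊)
  lemma₂ = solve-∀
  lemma₃ : ∀ A k →
    (A * ((k + 1) * (k + 4)) + A) * (2 * A + A) + A * A * (k * k + k + 1) ≡ 4 * (A * (A * ((k + 2) * (k + 2))))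
  lemma₃ = solve-∀
  lemma₄ : ∀ A c T → 4 * (A * (A * (c * c))) * (T * T) ≡ 4 * (A * (A * ((c * T) * (c * T))))
  lemma₄ = solve-∀

maxProd^-pos : ∀ d m → 0 < maxProd m ^ d
maxProd^-pos d m = subst (_≤ maxProd m ^ d) (^-zeroˡ d) (^-monoˡ-≤ d (maxProd-pos m))

maxProd^≤q : ∀ d m → 0 < maxCount m → maxProd m ^ d ≤ q d m
maxProd^≤q d m 0<c = ≤-trans (m≤n*m (maxProd m ^ d) (maxCount m) {{>-nonZero 0<c}}) (q-lower-bound d m)

4^≤9^ : ∀ m → 4 ^ (3 + m) ≤ 9 ^ (2 + m)
4^≤9^ zero    = ≤ᵇ⇒≤ _ _ _
4^≤9^ (suc m) = *-mono-≤ (≤ᵇ⇒≤ 4 9 _) (4^≤9^ m)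

[6+m]*4^≤3^ : ∀ m → (6 + m) * 4 ^ (5 + m) ≤ 3 ^ (9 + 2 * m)
[6+m]*4^≤3^ zero    = ≤ᵇ⇒≤ _ _ _
[6+m]*4^≤3^ (suc m) = begin
  (7 + m) * (4 * 4 ^ (5 + m))     ≡⟨ *-assoc (7 + m) 4 (4 ^ (5 + m)) ⟨
  (7 + m) * 4 * 4 ^ (5 + m)       ≤⟨ *-monoˡ-≤ (4 ^ (5 + m)) (7+m*4≤9*6+m m) ⟩
  9 * (6 + m) * 4 ^ (5 + m)       ≡⟨ *-assoc 9 (6 + m) (4 ^ (5 + m)) ⟩
  9 * ((6 + m) * 4 ^ (5 + m))     ≤⟨ *-monoʳ-≤ 9 ([6+m]*4^≤3^ m) ⟩
  9 * 3 ^ (9 + 2 * m)             ≡⟨ *-assoc 3 3 (3 ^ (9 + 2 * m)) ⟩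
  3 ^ (2 + (9 + 2 * m))           ≡⟨ cong (3 ^_) (lemma m) ⟩
  3 ^ (9 + 2 * suc m)             ∎
  where
  open ≤-Reasoning
  7+m*4≤9*6+m : ∀ m → (7 + m) * 4 ≤ 9 * (6 + m)
  7+m*4≤9*6+m m = ≤-trans (m≤m+n _ (26 + 5 * m)) (≤-reflexive (lemma′ m))
    where
    lemma′ : ∀ m → (7 + m) * 4 + (26 + 5 * m) ≡ 9 * (6 + m)
    lemma′ = solve-∀
  lemma : ∀ m → 2 + (9 + 2 * m) ≡ 9 + 2 * suc m
  lemma = solve-∀

q-log-concave-at-3+3k : ∀ d k → 3 ^ (2 * (3 + k * 3)) * 8 ^ d < 9 ^ d →
  q d (2 + k * 3) * q d (4 + k * 3) ≤ q d (3 + k * 3) * q d (3 + k * 3)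
q-log-concave-at-3+3k d k hyp =
  ratio-9/8⇒mul≤sq A B (q d n₋) (q d n₊) (q d n) (maxProd n₋ ^ d) (maxProd n₊ ^ d) (maxProd n ^ d)
    (maxCount n₋) (maxCount n₊) (3 ^ n₋) (3 ^ n₊)
    (m^n>0 9 d) (q-upper-bound d n₊ B*3^≤A n₋ (m≤n+m n₋ 2)) (q-upper-bound d n₊ B*3^≤A n₊ ≤-refl)
    (≤-trans (*-monoʳ-≤ B (^-monoʳ-≤ 3 (m≤n+m n₋ 2))) B*3^≤A) B*3^≤A
    (maxProd^≤q d n (subst (0 <_) (sym (maxCount-3+3k k)) z<s))
    (*-^-cong₃ d maxProd-ratio) (≤-trans (*-monoˡ-≤ B counts≤) (<⇒≤ hyp))
  where
  open ≤-Reasoning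
  n₋ n n₊ A B : ℕ
  n₋ = 2 + k * 3
  n  = 3 + k * 3
  n₊ = 4 + k * 3
  A = 9 ^ d
  B = 8 ^ d
  B*3^≤A : B * 3 ^ n₊ ≤ A
  B*3^≤A = ≤-trans (≤-reflexive (*-comm B _)) (≤-trans (*-monoˡ-≤ B (^-monoʳ-≤ 3 n₊≤2n)) (<⇒≤ hyp))
    where
    lemma : ∀ k → 4 + k * 3 + (2 + k * 3) ≡ 2 * (3 + k * 3)
    lemma = solve-∀
    n₊≤2n : n₊ ≤ 2 * n
    n₊≤2n = ≤-trans (m≤m+n n₊ n₋) (≤-reflexive (lemma k))
  maxProd-ratio : 9 * (maxProd n₋ * maxProd n₊) ≡ 8 * (maxProd n * maxProd n)
  maxProd-ratio rewrite maxProd-2+3k k | maxProd-4+3k k | maxProd-3k (suc k) = lemma (3 ^ k)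
    where
    lemma : ∀ x → 9 * (2 * x * (4 * x)) ≡ 8 * (3 * x * (3 * x))
    lemma = solve-∀
  counts≤ : (maxCount n₋ + 1) * (maxCount n₊ + 1) ≤ 3 ^ (2 * n)
  counts≤ = begin
    (maxCount n₋ + 1) * (maxCount n₊ + 1)  ≤⟨ *-mono-≤ (maxCount+1≤2^ n₋) (maxCount+1≤2^ n₊) ⟩
    2 ^ (3 + k * 3) * 2 ^ (5 + k * 3)      ≡⟨ ^-distribˡ-+-* 2 (3 + k * 3) (5 + k * 3) ⟨
    2 ^ (3 + k * 3 + (5 + k * 3))          ≡⟨ cong (2 ^_) (lemma k) ⟩
    2 ^ (2 * (4 + k * 3))                  ≡⟨ ^-*-assoc 2 2 (4 + k * 3) ⟨
    4 ^ (4 + k * 3)                        ≤⟨ 4^≤9^ (1 + k * 3) ⟩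
    9 ^ (3 + k * 3)                        ≡⟨ ^-*-assoc 3 2 (3 + k * 3) ⟩
    3 ^ (2 * (3 + k * 3))                  ∎
    where
    lemma : ∀ k → 3 + k * 3 + (5 + k * 3) ≡ 2 * (4 + k * 3)
    lemma = solve-∀

q-log-convex-at-4+3k : ∀ d k → 3 ^ (2 * (4 + k * 3) + 1) * 8 ^ d < ((4 + k * 3) + 2) * 9 ^ d →
  q d (4 + k * 3) * q d (4 + k * 3) < q d (3 + k * 3) * q d (5 + k * 3)
q-log-convex-at-4+3k d k hyp =
  ratio-8/9⇒sq<mul A B (q d n₋) (q d n₊) (q d n) (maxProd n₋ ^ d) (maxProd n₊ ^ d) (maxProd n ^ d) (maxCount n) (3 ^ n)
    (m^n>0 9 d) (*-mono-≤ (maxProd^-pos d n₋) (maxProd^-pos d n₊))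
    (q-upper-bound d n₊ (<⇒≤ B*3^<A) n (n≤1+n n)) (≤-trans (*-monoʳ-≤ B (^-monoʳ-≤ 3 (n≤1+n n))) (<⇒≤ B*3^<A))
    (maxProd^≤q d n₋ (subst (0 <_) (sym (maxCount-3+3k k)) z<s))
    (maxProd^≤q d n₊ (subst (0 <_) (sym (maxCount-2+3k (suc k))) z<s))
    (*-^-cong₃ d maxProd-ratio) counts<
  where
  open ≤-Reasoning
  n₋ n n₊ A B : ℕ
  n₋ = 3 + k * 3
  n  = 4 + k * 3
  n₊ = 5 + k * 3
  A = 9 ^ d
  B = 8 ^ d
  [n+2]*4^≤3^ : (n + 2) * 4 ^ suc n ≤ 3 ^ (2 * n + 1)
  [n+2]*4^≤3^ = subst₂ (λ a b → a * 4 ^ suc n ≤ 3 ^ b) (lemma₁ k) (lemma₂ k) ([6+m]*4^≤3^ (k * 3))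
    where
    lemma₁ : ∀ k → 6 + k * 3 ≡ 4 + k * 3 + 2
    lemma₁ = solve-∀
    lemma₂ : ∀ k → 9 + 2 * (k * 3) ≡ 2 * (4 + k * 3) + 1
    lemma₂ = solve-∀
  <A : ∀ x → x ≤ 4 ^ suc n → x * B < A
  <A x x≤ = *-cancelˡ-< (n + 2) _ _ (begin-strict
    (n + 2) * (x * B)               ≡⟨ *-assoc (n + 2) x B ⟨
    (n + 2) * x * B                 ≤⟨ *-monoˡ-≤ B (≤-trans (*-monoʳ-≤ (n + 2) x≤) [n+2]*4^≤3^) ⟩
    3 ^ (2 * n + 1) * B             <⟨ hyp ⟩
    (n + 2) * A                     ∎)
  B*3^<A : B * 3 ^ suc n < A
  B*3^<A = subst (_< A) (*-comm (3 ^ suc n) B) (<A (3 ^ suc n) (^-monoˡ-≤ (suc n) (≤ᵇ⇒≤ 3 4 _)))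
  counts< : (maxCount n + 1) * (maxCount n + 1) * B < A
  counts< = <A _ (begin
    (maxCount n + 1) * (maxCount n + 1)   ≤⟨ *-mono-≤ (maxCount+1≤2^ n) (maxCount+1≤2^ n) ⟩
    2 ^ suc n * 2 ^ suc n                  ≡⟨ ^-distribʳ-* 2 2 (suc n) ⟨
    4 ^ suc n                              ∎)
  maxProd-ratio : 9 * (maxProd n * maxProd n) ≡ 8 * (maxProd n₋ * maxProd n₊)
  maxProd-ratio rewrite maxProd-4+3k k | maxProd-3k (suc k) | maxProd-2+3k (suc k) = lemma (3 ^ k)
    where
    lemma : ∀ x → 9 * (4 * x * (4 * x)) ≡ 8 * (3 * x * (2 * (3 * x)))
    lemma = solve-∀

q-log-concave-at-5+3k : ∀ d k → 2 * 3 ^ (6 + k * 3) * 8 ^ d < 9 ^ d →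
  q d (4 + k * 3) * q d (6 + k * 3) ≤ q d (5 + k * 3) * q d (5 + k * 3)
q-log-concave-at-5+3k d k hyp =
  ratio-1⇒mul≤sq A (q d n₋) (q d n₊) (q d n) (maxProd n₋ ^ d) (maxProd n₊ ^ d) (maxProd n ^ d)
    (maxCount n₋) (maxCount n) (B * 3 ^ n₋) k (m^n>0 9 d)
    (q-upper-bound d n₊ B*3^≤A n₋ (m≤n+m n₋ 2)) upper₊ (q-lower-bound d n)
    (*-^-cong d maxProd-ratio) (maxCount-4+3k k) (trans (maxCount-2+3k (suc k)) (+-comm 2 k))
    (subst (_≤ A) (lemma₁ B (3 ^ n₋)) (<⇒≤ hyp))
  where
  n₋ n n₊ A B : ℕ
  n₋ = 4 + k * 3
  n  = 5 + k * 3
  n₊ = 6 + k * 3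
  A = 9 ^ d
  B = 8 ^ d
  lemma₁ : ∀ B x → 2 * (3 * (3 * x)) * B ≡ 18 * (B * x)
  lemma₁ = solve-∀
  B*3^≤A : B * 3 ^ n₊ ≤ A
  B*3^≤A = ≤-trans (≤-trans (≤-reflexive (*-comm B (3 ^ n₊))) (*-monoˡ-≤ B (m≤n*m (3 ^ n₊) 2))) (<⇒≤ hyp)
  upper₊ : A * q d n₊ ≤ (A * 1 + 9 * (B * 3 ^ n₋)) * maxProd n₊ ^ d
  upper₊ = subst₂ (λ c x → A * q d n₊ ≤ (A * c + x) * maxProd n₊ ^ d)
    (maxCount-3+3k (suc k)) (lemma₂ B (3 ^ n₋)) (q-upper-bound d n₊ B*3^≤A n₊ ≤-refl)
    where
    lemma₂ : ∀ B x → B * (3 * (3 * x)) ≡ 9 * (B * x)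
    lemma₂ = solve-∀
  maxProd-ratio : maxProd n * maxProd n ≡ maxProd n₋ * maxProd n₊
  maxProd-ratio rewrite maxProd-2+3k (suc k) | maxProd-4+3k k | maxProd-3k (suc (suc k)) = lemma (3 ^ k)
    where
    lemma : ∀ x → 2 * (3 * x) * (2 * (3 * x)) ≡ 4 * x * (3 * (3 * x))
    lemma = solve-∀

private
  ≤⇒¬^2< : ∀ a b c → a * b ≤ c * c → ¬ (c ^ 2 < a * b)
  ≤⇒¬^2< a b c ab≤c² c²<ab = <⇒≱ (subst (_< a * b) (cong (c *_) (*-identityʳ c)) c²<ab) ab≤c²

  *<⇒^2< : ∀ a b c → c * c < a * b → c ^ 2 < a * b
  *<⇒^2< a b c = subst (_< a * b) (cong (c *_) (sym (*-identityʳ c)))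

DBound-5+3k : ∀ d k → DBound (5 + k * 3) d → 2 * 3 ^ (6 + k * 3) * 8 ^ d < 9 ^ d
DBound-5+3k d zero    (_ , _ , _ , h₅) = ≤-<-trans (*-monoˡ-≤ (8 ^ d) (≤ᵇ⇒≤ 1458 3888 _)) (h₅ refl)
DBound-5+3k d (suc k) (_ , _ , h₂ , _) =
  subst (λ e → 2 * 3 ^ e * 8 ^ d < 9 ^ d) (+-comm (8 + k * 3) 1) (h₂ ([m+kn]%n≡m%n 2 (2 + k) 3) (λ ()))

corollary2 : (n d : ℕ) → 3 ≤ n → DBound n d →
    ((q d n ^ 2 < q d (n ∸ 1) * q d (suc n)) ⇔ (n % 3 ≡ 1))
corollary2 n d 3≤n bound with n divMod 3
corollary2 .(0 + suc k * 3) d _ (h₀ , _) | result (suc k) zero refl = mk⇔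
  (⊥-elim ∘ ≤⇒¬^2< (q d (2 + k * 3)) (q d (4 + k * 3)) (q d (3 + k * 3)) (q-log-concave-at-3+3k d k (h₀ ≡0)))
  (λ ≡1 → ⊥-elim (0≢1+n (trans (sym ≡0) ≡1)))
  where
  ≡0 : (3 + k * 3) % 3 ≡ 0
  ≡0 = [m+kn]%n≡m%n 0 (suc k) 3
corollary2 .(1 + suc k * 3) d _ (_ , h₁ , _) | result (suc k) (suc zero) refl = mk⇔
  (λ _ → ≡1)
  (λ _ → *<⇒^2< (q d (3 + k * 3)) (q d (5 + k * 3)) (q d (4 + k * 3)) (q-log-convex-at-4+3k d k (h₁ ≡1)))
  where
  ≡1 : (4 + k * 3) % 3 ≡ 1
  ≡1 = [m+kn]%n≡m%n 1 (suc k) 3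
corollary2 .(2 + suc k * 3) d _ bound | result (suc k) (suc (suc zero)) refl = mk⇔
  (⊥-elim ∘ ≤⇒¬^2< (q d (4 + k * 3)) (q d (6 + k * 3)) (q d (5 + k * 3))
     (q-log-concave-at-5+3k d k (DBound-5+3k d k bound)))
  (λ ≡1 → ⊥-elim (1+n≢0 (suc-injective (trans (sym ≡2) ≡1))))
  where
  ≡2 : (5 + k * 3) % 3 ≡ 2
  ≡2 = [m+kn]%n≡m%n 2 (suc k) 3
corollary2 .(0 + 0 * 3) d () _ | result zero zero refl
corollary2 .(1 + 0 * 3) d (s≤s ()) _ | result zero (suc zero) refl
corollary2 .(2 + 0 * 3) d (s≤s (s≤s ())) _ | result zero (suc (suc zero)) refl
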